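{- Let $\mathsf{III}$ (call-by-name), $\mathsf{IIS}$ and $\mathsf{SII}$ (head spine) be the uniform evaluators described in the context. Then $\mathsf{IIS}$ absorbs $\mathsf{III}$ and $\mathsf{SII}$ absorbs $\mathsf{III}$, i.e. $\mathsf{IIS}\circ\mathsf{III}=\mathsf{IIS}$ and $\mathsf{SII}\circ\mathsf{III}=\mathsf{SII}$ as partial functions on $\lambda$-terms.
   Context: Terms: $\Lambda ::= x\mid \lambda x.\Lambda\mid \Lambda\Lambda$ (modulo $\alpha$); $[N/x]B$ is capture-avoiding substitution. An evaluator is a partial function $\Lambda\rightharpoonup\Lambda$ (undefined = divergence); $\mathrm{id}$ is the identity; $(E_2\circ E_1)(M)=E_2(E_1(M))$, undefined if $E_1(M)$ is undefined. $E_2$ absorbs $E_1$ iff $E_2\circ E_1=E_2$. Eval-apply template: $E$ is the least partial function with $E(x)=x$; $E(\lambda x.B)=\lambda x.\mathit{la}(B)$; for $E(MN)$: compute $M'=\mathit{op}_1(M)$; if $M'\equiv\lambda x.B$, compute $N'=\mathit{ar}_1(N)$ and return $E([N'/x]B)$; otherwise compute $M''=\mathit{op}_2(M')$, then $N'=\mathit{ar}_2(N)$, and return $M''N'$ (in this order; divergence propagates). For a triple $XYZ$ with $X,Y,Z\in\{\mathsf I,\mathsf S\}$, the uniform evaluator $XYZ$ is the instance with $\mathit{op}_1=E$, $\mathit{op}_2=\mathrm{id}$, and $\mathit{la},\mathit{ar}_1,\mathit{ar}_2$ given respectively by $X,Y,Z$, where $\mathsf I$ means $\mathrm{id}$ and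 $\mathsf S$ means $E$ itself. Thus $\mathsf{III}$ is call-by-name, $\mathsf{SII}$ is head spine, and $\mathsf{IIS}$ is weak, non-strict and evaluates operands of neutral terms. -}

module Defs where

open import Data.Nat using (ℕ; zero; suc)
open import Data.Bool using (Bool; true; false)
open import Data.Product using (∃; _×_)
open import Relation.Binary.PropositionalEquality using (_≡_)
open import Function.Bundles using (_⇔_)

-- λ-terms modulo α: de Bruijn indices (var 0 = innermost binder)
data Λ : Set where
  var : ℕ → Λ
  lam : Λ → Λ
  app : Λ → Λ → Λ

ext : (ℕ → ℕ) → ℕ → ℕ
ext ρ zero    = zero
ext ρ (suc n) = suc (ρ n)

rename : (ℕ → ℕ) → Λ → Λ
rename ρ (var n)   = var (ρ n)
rename ρ (lam B)   = lam (rename (ext ρ) B)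
rename ρ (app M N) = app (rename ρ M) (rename ρ N)

exts : (ℕ → Λ) → ℕ → Λ
exts σ zero    = var zero
exts σ (suc n) = rename suc (σ n)

subst : (ℕ → Λ) → Λ → Λ
subst σ (var n)   = σ n
subst σ (lam B)   = lam (subst (exts σ) B)
subst σ (app M N) = app (subst σ M) (subst σ N)

-- [N/x]B where x is the variable bound by the λ whose body is B
sub0 : Λ → ℕ → Λ
sub0 N zero    = N
sub0 N (suc n) = var n

_[_] : Λ → Λ → Λ
B [ N ] = subst (sub0 N) B

isLam : Λ → Bool
isLam (lam _) = true
isLam _       = false

-- Strategy parameters: I = identity, S = the evaluator itself
data Strat : Set where
  I S : Strat

-- The uniform evaluator XYZ (op₁ = E, op₂ = id), as the least relation
-- (big-step graph of the least partial function).
-- Ev x y z M V : "XYZ(M) = V";  Use x y z s M V : "s(M) = V" for s ∈ {I,S}.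
mutual
  data Ev (x y z : Strat) : Λ → Λ → Set where
    ev-var : ∀ {n} → Ev x y z (var n) (var n)
    ev-lam : ∀ {B B'} → Use x y z x B B' → Ev x y z (lam B) (lam B')
    ev-β   : ∀ {M N B N' V} → Ev x y z M (lam B) → Use x y z y N N' →
             Ev x y z (B [ N' ]) V → Ev x y z (app M N) V
    ev-neu : ∀ {M N M' N'} → Ev x y z M M' → isLam M' ≡ false →
             Use x y z z N N' → Ev x y z (app M N) (app M' N')

  data Use (x y z : Strat) : Strat → Λ → Λ → Set where
    use-I : ∀ {M} → Use x y z I M M
    use-S : ∀ {M V} → Ev x y z M V → Use x y z S M V

Evaluator : Set₁
Evaluator = Λ → Λ → Set

_∘E_ : Evaluator → Evaluator → Evaluator
(E₂ ∘E E₁) M V = ∃ λ M' → E₁ M M' × E₂ M' V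

Absorbs : Evaluator → Evaluator → Set
Absorbs E₂ E₁ = ∀ M V → (E₂ ∘E E₁) M V ⇔ E₂ M V

III IIS SII : Evaluator
III = Ev I I I
IIS = Ev I I S
SII = Ev S I I

-- IIS ∘ III = IIS is a direct induction: neither evaluator enters λ-bodies and
-- IIS differs from III only in also evaluating the operands of neutral terms;
-- the III-value of a term is a weak head normal form, on which IIS does exactly
-- that remaining operand work.
--
-- For SII both evaluators are read off head reduction, which is deterministic:
-- SII M is the head normal form of M and III M is the first weak head normal
-- form on the head-reduction path of M, so SII (III M) = SII M.  Completeness
-- of SII for head reduction is by induction on the length of the reduction:
-- after the root β-step the reduct B [ N ] reaches its head normal form only
-- through a head normal form of B, and both resulting reductions are shorter.
module Submission where

open import Defs
open import Data.Bool using (false)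
open import Data.Empty using (⊥; ⊥-elim)
open import Data.Nat using (ℕ; zero; suc; _+_; _<_; s≤s)
open import Data.Nat.Properties using (≤-trans; +-monoʳ-≤; m≤m+n; m≤n+m)
open import Data.Nat.Induction using (<-rec)
open import Data.Product using (_×_; _,_; ∃-syntax)
open import Data.Sum using (_⊎_; inj₁; inj₂)
open import Function using (_∘_)
open import Function.Bundles using (mk⇔)
open import Relation.Binary.PropositionalEquality
  using (_≡_; refl; sym; trans; cong; cong₂; _≗_; module ≡-Reasoning)

ext-cong : ∀ {ρ ρ'} → ρ ≗ ρ' → ext ρ ≗ ext ρ'
ext-cong e zero    = refl
ext-cong e (suc n) = cong suc (e n)

rename-cong : ∀ {ρ ρ'} → ρ ≗ ρ' → rename ρ ≗ rename ρ'
rename-cong e (var n)   = cong var (e n)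
rename-cong e (lam B)   = cong lam (rename-cong (ext-cong e) B)
rename-cong e (app M N) = cong₂ app (rename-cong e M) (rename-cong e N)

exts-cong : ∀ {σ σ'} → σ ≗ σ' → exts σ ≗ exts σ'
exts-cong e zero    = refl
exts-cong e (suc n) = cong (rename suc) (e n)

subst-cong : ∀ {σ σ'} → σ ≗ σ' → subst σ ≗ subst σ'
subst-cong e (var n)   = e n
subst-cong e (lam B)   = cong lam (subst-cong (exts-cong e) B)
subst-cong e (app M N) = cong₂ app (subst-cong e M) (subst-cong e N)

ext-∘ : ∀ ρ ρ' → ext ρ ∘ ext ρ' ≗ ext (ρ ∘ ρ')
ext-∘ ρ ρ' zero    = refl
ext-∘ ρ ρ' (suc n) = refl

rename-∘ : ∀ ρ ρ' M → rename ρ (rename ρ' M) ≡ rename (ρ ∘ ρ') M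
rename-∘ ρ ρ' (var n)   = refl
rename-∘ ρ ρ' (lam B)   =
  cong lam (trans (rename-∘ (ext ρ) (ext ρ') B) (rename-cong (ext-∘ ρ ρ') B))
rename-∘ ρ ρ' (app M N) = cong₂ app (rename-∘ ρ ρ' M) (rename-∘ ρ ρ' N)

rename-exts : ∀ ρ σ → rename (ext ρ) ∘ exts σ ≗ exts (rename ρ ∘ σ)
rename-exts ρ σ zero    = refl
rename-exts ρ σ (suc n) =
  trans (rename-∘ (ext ρ) suc (σ n)) (sym (rename-∘ suc ρ (σ n)))

rename-subst : ∀ ρ σ M → rename ρ (subst σ M) ≡ subst (rename ρ ∘ σ) M
rename-subst ρ σ (var n)   = refl
rename-subst ρ σ (lam B)   =
  cong lam (trans (rename-subst (ext ρ) (exts σ) B) (subst-cong (rename-exts ρ σ) B))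
rename-subst ρ σ (app M N) = cong₂ app (rename-subst ρ σ M) (rename-subst ρ σ N)

exts-ext : ∀ σ ρ → exts σ ∘ ext ρ ≗ exts (σ ∘ ρ)
exts-ext σ ρ zero    = refl
exts-ext σ ρ (suc n) = refl

subst-rename : ∀ σ ρ M → subst σ (rename ρ M) ≡ subst (σ ∘ ρ) M
subst-rename σ ρ (var n)   = refl
subst-rename σ ρ (lam B)   =
  cong lam (trans (subst-rename (exts σ) (ext ρ) B) (subst-cong (exts-ext σ ρ) B))
subst-rename σ ρ (app M N) = cong₂ app (subst-rename σ ρ M) (subst-rename σ ρ N)

subst-exts : ∀ σ τ → subst (exts σ) ∘ exts τ ≗ exts (subst σ ∘ τ)
subst-exts σ τ zero    = refl
subst-exts σ τ (suc n) =
  trans (subst-rename (exts σ) suc (τ n)) (sym (rename-subst suc σ (τ n)))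

subst-∘ : ∀ σ τ M → subst σ (subst τ M) ≡ subst (subst σ ∘ τ) M
subst-∘ σ τ (var n)   = refl
subst-∘ σ τ (lam B)   =
  cong lam (trans (subst-∘ (exts σ) (exts τ) B) (subst-cong (subst-exts σ τ) B))
subst-∘ σ τ (app M N) = cong₂ app (subst-∘ σ τ M) (subst-∘ σ τ N)

subst-id : ∀ {σ} → σ ≗ var → ∀ M → subst σ M ≡ M
subst-id e (var n)   = e n
subst-id e (lam B)   = cong lam (subst-id (λ { zero → refl ; (suc n) → cong (rename suc) (e n) }) B)
subst-id e (app M N) = cong₂ app (subst-id e M) (subst-id e N)

subst-[] : ∀ σ B N → subst σ (B [ N ]) ≡ subst (exts σ) B [ subst σ N ]
subst-[] σ B N = begin
  subst σ (subst (sub0 N) B)                     ≡⟨ subst-∘ σ (sub0 N) B ⟩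
  subst (subst σ ∘ sub0 N) B                     ≡⟨ subst-cong sub0-exts B ⟩
  subst (subst (sub0 (subst σ N)) ∘ exts σ) B    ≡⟨ sym (subst-∘ (sub0 (subst σ N)) (exts σ) B) ⟩
  subst (sub0 (subst σ N)) (subst (exts σ) B)    ∎
  where
  open ≡-Reasoning
  sub0-exts : subst σ ∘ sub0 N ≗ subst (sub0 (subst σ N)) ∘ exts σ
  sub0-exts zero    = refl
  sub0-exts (suc n) =
    sym (trans (subst-rename (sub0 (subst σ N)) suc (σ n)) (subst-id (λ _ → refl) (σ n)))

infix 4 _⟶_ _⟶[_]_ _↠_

data _⟶_ : Λ → Λ → Set where
  β    : ∀ {B N} → app (lam B) N ⟶ B [ N ]
  ξlam : ∀ {B B'} → B ⟶ B' → lam B ⟶ lam B'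
  ξapp : ∀ {M M' N} → isLam M ≡ false → M ⟶ M' → app M N ⟶ app M' N

data _⟶[_]_ : Λ → ℕ → Λ → Set where
  done : ∀ {M} → M ⟶[ 0 ] M
  step : ∀ {M M' n V} → M ⟶ M' → M' ⟶[ n ] V → M ⟶[ suc n ] V

_↠_ : Λ → Λ → Set
M ↠ V = ∃[ n ] M ⟶[ n ] V

data Ne : Λ → Set where
  ne-var : ∀ {n} → Ne (var n)
  ne-app : ∀ {H N} → Ne H → Ne (app H N)

data Hnf : Λ → Set where
  hnf-lam : ∀ {B} → Hnf B → Hnf (lam B)
  hnf-ne  : ∀ {H} → Ne H → Hnf H

data Whnf : Λ → Set where
  whnf-lam : ∀ {B} → Whnf (lam B)
  whnf-ne  : ∀ {H} → Ne H → Whnf H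

ne-isLam : ∀ {H} → Ne H → isLam H ≡ false
ne-isLam ne-var     = refl
ne-isLam (ne-app _) = refl

whnf⇒ne : ∀ {H} → Whnf H → isLam H ≡ false → Ne H
whnf⇒ne (whnf-ne h) _ = h

hnf-whnf : ∀ {H} → Hnf H → Whnf H
hnf-whnf (hnf-lam _) = whnf-lam
hnf-whnf (hnf-ne h)  = whnf-ne h

hnf-lam⁻¹ : ∀ {B} → Hnf (lam B) → Hnf B
hnf-lam⁻¹ (hnf-lam h) = h

hnf-app⁻¹ : ∀ {P N} → Hnf (app P N) → Ne P
hnf-app⁻¹ (hnf-ne (ne-app h)) = h

ne-irreducible : ∀ {H H'} → Ne H → H ⟶ H' → ⊥
ne-irreducible (ne-app ()) β
ne-irreducible (ne-app h) (ξapp _ s) = ne-irreducible h s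

hnf-irreducible : ∀ {H H'} → Hnf H → H ⟶ H' → ⊥
hnf-irreducible (hnf-lam h) (ξlam s) = hnf-irreducible h s
hnf-irreducible (hnf-ne h) s         = ne-irreducible h s

⟶-deterministic : ∀ {M M₁ M₂} → M ⟶ M₁ → M ⟶ M₂ → M₁ ≡ M₂
⟶-deterministic β          β          = refl
⟶-deterministic (ξlam s)   (ξlam t)   = cong lam (⟶-deterministic s t)
⟶-deterministic (ξapp _ s) (ξapp _ t) = cong (λ X → app X _) (⟶-deterministic s t)

hnf-or-step : ∀ M → Hnf M ⊎ ∃[ M' ] M ⟶ M'
hnf-or-step (var n) = inj₁ (hnf-ne ne-var)
hnf-or-step (lam B) with hnf-or-step B
... | inj₁ h        = inj₁ (hnf-lam h)
... | inj₂ (_ , s) = inj₂ (_ , ξlam s)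
hnf-or-step (app (var n) N)   = inj₁ (hnf-ne (ne-app ne-var))
hnf-or-step (app (lam B) N)   = inj₂ (_ , β)
hnf-or-step (app (app P Q) N) with hnf-or-step (app P Q)
... | inj₁ (hnf-ne h) = inj₁ (hnf-ne (ne-app h))
... | inj₂ (_ , s)    = inj₂ (_ , ξapp refl s)

isLam-subst : ∀ σ {M M'} → M ⟶ M' → isLam M ≡ false → isLam (subst σ M) ≡ false
isLam-subst σ β          _ = refl
isLam-subst σ (ξapp _ _) _ = refl
isLam-subst σ (ξlam _)   ()

⟶-subst : ∀ σ {M M'} → M ⟶ M' → subst σ M ⟶ subst σ M'
⟶-subst σ (β {B} {N}) rewrite subst-[] σ B N = β
⟶-subst σ (ξlam s)                         = ξlam (⟶-subst (exts σ) s)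
⟶-subst σ (ξapp e s)                       = ξapp (isLam-subst σ s e) (⟶-subst σ s)

_++_ : ∀ {M M' V n m} → M ⟶[ n ] M' → M' ⟶[ m ] V → M ⟶[ n + m ] V
done     ++ r' = r'
step s r ++ r' = step s (r ++ r')

↠-trans : ∀ {M M' V} → M ↠ M' → M' ↠ V → M ↠ V
↠-trans (_ , r) (_ , r') = _ , r ++ r'

⟶[]-lam : ∀ {B B' n} → B ⟶[ n ] B' → lam B ⟶[ n ] lam B'
⟶[]-lam done       = done
⟶[]-lam (step s r) = step (ξlam s) (⟶[]-lam r)

⟶[]-lam⁻¹ : ∀ {B n W} → lam B ⟶[ n ] W → ∃[ B' ] W ≡ lam B' × B ⟶[ n ] B'
⟶[]-lam⁻¹ done = _ , refl , done
⟶[]-lam⁻¹ (step (ξlam s) r) with ⟶[]-lam⁻¹ r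
... | _ , refl , r' = _ , refl , step s r'

⟶[]-subst : ∀ σ {B B' n} → B ⟶[ n ] B' → subst σ B ⟶[ n ] subst σ B'
⟶[]-subst σ done       = done
⟶[]-subst σ (step s r) = step (⟶-subst σ s) (⟶[]-subst σ r)

⟶[]-appˡ : ∀ {P P' N k} → P ⟶[ k ] P' → isLam P' ≡ false → app P N ⟶[ k ] app P' N
⟶[]-appˡ done e = done
⟶[]-appˡ {P = lam _} r e with ⟶[]-lam⁻¹ r
⟶[]-appˡ {P = lam _} r () | _ , refl , _
⟶[]-appˡ {P = app _ _} (step s r) e = step (ξapp refl s) (⟶[]-appˡ r e)

app-β : ∀ {P B k} N → P ⟶[ k ] lam B → app P N ↠ B [ N ]
app-β {P = lam _} N r with ⟶[]-lam⁻¹ r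
... | _ , refl , r' = _ , step β (⟶[]-subst (sub0 N) r')
app-β {P = var _}   N (step () _)
app-β {P = app _ _} N (step s r) with app-β N r
... | _ , r' = _ , step (ξapp refl s) r'

data AppReduction (P N : Λ) : ℕ → Λ → Set where
  contracts     : ∀ {k m B V} → P ⟶[ k ] lam B → B [ N ] ⟶[ m ] V →
                  AppReduction P N (suc (k + m)) V
  operator-only : ∀ {n P'} → P ⟶[ n ] P' → AppReduction P N n (app P' N)

app-reduction : ∀ {P N n V} → app P N ⟶[ n ] V → AppReduction P N n V
app-reduction done                = operator-only done
app-reduction (step β r)          = contracts done r
app-reduction (step (ξapp _ s) r) with app-reduction r
... | contracts rP rB  = contracts (step s rP) rB
... | operator-only rP = operator-only (step s rP)

data SubstReduction (σ : ℕ → Λ) (B : Λ) : ℕ → Λ → Set where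
  hnf-first : ∀ {j i B' V} → B ⟶[ j ] B' → Hnf B' → subst σ B' ⟶[ i ] V →
              SubstReduction σ B (j + i) V

subst-reduction : ∀ σ B {m V} → subst σ B ⟶[ m ] V → Hnf V → SubstReduction σ B m V
subst-reduction σ B r hV with hnf-or-step B
... | inj₁ hB = hnf-first done hB r
... | inj₂ (B' , s) with r
...   | done = ⊥-elim (hnf-irreducible hV (⟶-subst σ s))
...   | step t r' with ⟶-deterministic t (⟶-subst σ s)
...     | refl with subst-reduction σ B' r' hV
...       | hnf-first rB hB' r'' = hnf-first (step s rB) hB' r''

Ev-whnf : ∀ {x y z M V} → Ev x y z M V → Whnf V
Ev-whnf ev-var         = whnf-ne ne-var
Ev-whnf (ev-lam _)     = whnf-lam
Ev-whnf (ev-β _ _ d)   = Ev-whnf d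
Ev-whnf (ev-neu d e _) = whnf-ne (ne-app (whnf⇒ne (Ev-whnf d) e))

Ev-ne-isLam : ∀ {x y z H W} → Ne H → Ev x y z H W → isLam W ≡ false
Ev-ne-isLam ne-var     ev-var         = refl
Ev-ne-isLam (ne-app _) (ev-neu _ _ _) = refl
Ev-ne-isLam (ne-app h) (ev-β d _ _) with Ev-ne-isLam h d
... | ()

Ev-isLam-reflect : ∀ {x y z M W} → Ev x y z M W → isLam W ≡ false → isLam M ≡ false
Ev-isLam-reflect ev-var         _ = refl
Ev-isLam-reflect (ev-β _ _ _)   _ = refl
Ev-isLam-reflect (ev-neu _ _ _) _ = refl

Ev-I-lam : ∀ {y z B W} → Ev I y z (lam B) W → W ≡ lam B
Ev-I-lam (ev-lam use-I) = refl

SII-sound : ∀ {M V} → SII M V → M ↠ V × Hnf V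
SII-sound ev-var = (0 , done) , hnf-ne ne-var
SII-sound (ev-lam (use-S d)) with SII-sound d
... | (_ , r) , h = (_ , ⟶[]-lam r) , hnf-lam h
SII-sound (ev-β {N = N} d use-I d') with SII-sound d | SII-sound d'
... | (_ , r) , _ | r' , h = ↠-trans (app-β N r) r' , h
SII-sound (ev-neu d e use-I) with SII-sound d
... | (_ , r) , h = (_ , ⟶[]-appˡ r e) , hnf-ne (ne-app (whnf⇒ne (hnf-whnf h) e))

SII-complete-for : ℕ → Set
SII-complete-for n = ∀ {M V} → M ⟶[ n ] V → Hnf V → SII M V

SII-complete-below : ∀ {n} → (∀ {m} → m < n → SII-complete-for m) → SII-complete-for n
SII-complete-below ih {var _} done _ = ev-var
SII-complete-below ih {var _} (step () _) _
SII-complete-below ih {lam _} r hV with ⟶[]-lam⁻¹ r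
... | _ , refl , r' = ev-lam (use-S (SII-complete-below ih r' (hnf-lam⁻¹ hV)))
SII-complete-below ih {app P N} r hV with app-reduction r
... | operator-only rP =
  ev-neu (SII-complete-below ih rP (hnf-ne (hnf-app⁻¹ hV))) (ne-isLam (hnf-app⁻¹ hV)) use-I
... | contracts {k = k} {B = B} rP rB with subst-reduction (sub0 N) B rB hV
...   | hnf-first {j = j} {i = i} rB' hB' r' =
  ev-β (ih (s≤s (+-monoʳ-≤ k (m≤m+n j i))) (rP ++ ⟶[]-lam rB') (hnf-lam hB'))
       use-I
       (ih (s≤s (≤-trans (m≤n+m i j) (m≤n+m (j + i) k))) r' hV)

SII-complete : ∀ {n} → SII-complete-for n
SII-complete {n} = <-rec SII-complete-for (λ _ → SII-complete-below) n

III-sound : ∀ {M V} → III M V → M ↠ V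
III-sound ev-var         = 0 , done
III-sound (ev-lam use-I) = 0 , done
III-sound (ev-β {N = N} d use-I d') with III-sound d
... | _ , r = ↠-trans (app-β N r) (III-sound d')
III-sound (ev-neu d e use-I) with III-sound d
... | _ , r = _ , ⟶[]-appˡ r e

III-ne-refl : ∀ {H} → Ne H → III H H
III-ne-refl ne-var     = ev-var
III-ne-refl (ne-app h) = ev-neu (III-ne-refl h) (ne-isLam h) use-I

III-whnf-refl : ∀ {V} → Whnf V → III V V
III-whnf-refl whnf-lam    = ev-lam use-I
III-whnf-refl (whnf-ne h) = III-ne-refl h

III-expand : ∀ {M M' V} → isLam M ≡ false → M ⟶ M' → III M' V → III M V
III-expand _ β d = ev-β (ev-lam use-I) use-I d
III-expand _ (ξapp e s) (ev-β d u d') = ev-β (III-expand e s d) u d'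
III-expand _ (ξapp e s) (ev-neu d e' u) = ev-neu (III-expand e s d) e' u

III-factor : ∀ {M V n} → M ⟶[ n ] V → Whnf V → ∃[ M' ] III M M' × M' ↠ V
III-factor done w = _ , III-whnf-refl w , (0 , done)
III-factor r@(step (ξlam _) _) _ = _ , ev-lam use-I , (_ , r)
III-factor (step s@β r) w with III-factor r w
... | M' , d , r' = M' , III-expand refl s d , r'
III-factor (step s@(ξapp _ _) r) w with III-factor r w
... | M' , d , r' = M' , III-expand refl s d , r'

SII-absorbs-III : Absorbs SII III
SII-absorbs-III M V = mk⇔ to from
  where
  to : (SII ∘E III) M V → SII M V
  to (_ , d , d') with III-sound d | SII-sound d'
  ... | (_ , r) | (_ , r') , h = SII-complete (r ++ r') h
  from : SII M V → (SII ∘E III) M V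
  from d with SII-sound d
  ... | (_ , r) , h with III-factor r (hnf-whnf h)
  ...   | M' , d' , (_ , r') = M' , d' , SII-complete r' h

IIS-expand : ∀ {M M' V} → III M M' → IIS M' V → IIS M V
IIS-expand ev-var         d = d
IIS-expand (ev-lam use-I) d = d
IIS-expand (ev-β a use-I b) d = ev-β (IIS-expand a (ev-lam use-I)) use-I (IIS-expand b d)
IIS-expand (ev-neu a e use-I) (ev-β c _ _) with Ev-ne-isLam (whnf⇒ne (Ev-whnf a) e) c
... | ()
IIS-expand (ev-neu a _ use-I) (ev-neu c e u) = ev-neu (IIS-expand a c) e u

IIS-factor : ∀ {M V} → IIS M V → (IIS ∘E III) M V
IIS-factor ev-var         = _ , ev-var , ev-var
IIS-factor (ev-lam use-I) = _ , ev-lam use-I , ev-lam use-I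
IIS-factor (ev-β d use-I d') with IIS-factor d | IIS-factor d'
... | _ , a , c | M' , b , e with Ev-whnf a
...   | whnf-ne h with Ev-ne-isLam h c
...     | ()
IIS-factor (ev-β d use-I d') | _ , a , c | M' , b , e | whnf-lam with Ev-I-lam c
...     | refl = M' , ev-β a use-I b , e
IIS-factor (ev-neu {N = N} d e u) with IIS-factor d
... | P' , a , c = app P' N , ev-neu a (Ev-isLam-reflect c e) use-I , ev-neu c e u

IIS-absorbs-III : Absorbs IIS III
IIS-absorbs-III M V = mk⇔ (λ { (_ , a , d) → IIS-expand a d }) IIS-factor

proposition7p7 : Absorbs IIS III × Absorbs SII III
proposition7p7 = IIS-absorbs-III , SII-absorbs-III
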